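{- Let $P$ be a strict Koike–Terada Gelfand–Tsetlin-type pattern satisfying rules (R1)–(R3) of the context, and let $O$ be an orientation of the edges of the Koike–Terada lattice for $P$ satisfying the conditions in the context. Then the following are equivalent: (1) $P$ satisfies rules (R4) and (R5); (2) for every $k\in\{1,\dots,n\}$, no ordinary vertex in the row labeled $k$ has type NS, SE, or EW, and the tie vertex of row $k$ has its west edge pointing toward it and is of one of the types $U$ (south edge points up into it, north edge points up away from it), $D$ (north edge points down into it, south edge points down away from it), or $O$ (north edge points up and south edge points down, both away from it).
   Context: Koike–Terada Gelfand–Tsetlin-type pattern: an array with $3n$ rows labeled from bottom to top $1,\bar1,\bar{\bar1},2,\bar2,\bar{\bar2},\dots,n,\bar n,\bar{\bar n}$, whose top row $\bar{\bar n}$ is $\lambda=(\lambda_n,\dots,\lambda_1)$. Rules: (R1) rows $i,\bar i,\bar{\bar i}$ each have $i$ nonnegative integer entries; (R2) entries weakly decrease along each row; (R3) each entry $b$ satisfies $a\le b\le c$, where $c$ is the entry above-left and $a$ the entry above-right of $b$ (taken as $0$ if absent); explicitly, if row $i+1$ is $(e_1,\dots,e_{i+1})$, row $\bar{\bar i}$ is $(d_1,\dots,d_i)$, row $\bar i$ is $(f_1,\dots,f_i)$ and row $i$ is $(g_1,\dots,g_i)$, then $e_j\ge d_j\ge e_{j+1}$, $d_j\ge f_j\ge d_{j+1}$, $f_j\ge g_j\ge f_{j+1}$ with $d_{i+1}=f_{i+1}=0$; (R4) the last entry of row $i$ is $0$ or $1$, for $i=1,\dots,n$; (R5) for $i=1,\dots,n-1$,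 every entry of row $\bar{\bar i}$ is left-leaning, i.e. $d_j=e_j$ for all $j$. The pattern is strict if every row is strictly decreasing. Koike–Terada lattice for $P$: columns labeled $\lambda_n,\dots,1$ from left to right; $3n$ rows labeled from bottom to top $1,\bar1,\bar{\bar1},\dots,n,\bar n,\bar{\bar n}$. In every row labeled by an unbarred $k$, the vertex in column $1$ is a "tie" vertex having only west, north and south edges; all other vertices ("ordinary") have four edges. For each $k$ the right boundary edges of rows $\bar{\bar k}$ and $\bar k$ are joined at a bend. The orientation $O$ satisfies: the vertical edge directly above the vertex in row $X$ and column $c$ points up iff $c$ is an entry of row $X$ of $P$ (down otherwise); vertical edges below row $1$ point down; left boundary edges point right (into the lattice); every ordinary vertex has exactly two incident edges pointing toward it and two pointing away. The type of an ordinary vertex is the pair of its edges pointing toward it (NW, NE, SW, SE, NS, EW). -}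

module Defs where

open import Data.Nat using (ℕ; zero; suc; _≤_; _<_; _≥_; _>_)
open import Data.Bool using (Bool; true; false)
open import Data.Vec using (Vec; []; _∷_)
open import Data.Vec.Membership.Propositional using (_∈_)
open import Data.Product using (_×_; Σ)
open import Data.Sum using (_⊎_)
open import Data.Empty using (⊥)
open import Relation.Nullary using (¬_)
open import Relation.Binary.PropositionalEquality using (_≡_)

-- The row labelled k (unbarred), k̄ and k̿ are encoded as (k , unb),
-- (k , bar), (k , dbar).  Bottom-to-top order:
--   (1,unb) < (1,bar) < (1,dbar) < (2,unb) < ... < (n,dbar).

data Kind : Set where
  unb bar dbar : Kind

-- A Koike–Terada GT-type array (rule R1 built in): row (k , κ) has
-- exactly k nonnegative integer entries.  Only rows with 1 ≤ k ≤ n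
-- are meaningful (the values at k = 0 or k > n are never used).
Pattern : Set
Pattern = (k : ℕ) → Kind → Vec ℕ k

-- 1-based access to the entries of a row: entry v j is the j-th entry
-- (from the left) of v, taken as 0 if absent (as in rule R3).
entry : ∀ {k} → Vec ℕ k → ℕ → ℕ
entry []       _               = 0
entry (x ∷ xs) zero            = 0
entry (x ∷ xs) (suc zero)      = x
entry (x ∷ xs) (suc (suc j))   = entry xs (suc j)

lambdaTop : ℕ → Pattern → ℕ
lambdaTop n P = entry (P n dbar) 1

R2 : ℕ → Pattern → Set
R2 n P = ∀ k κ j → 1 ≤ k → k ≤ n → 1 ≤ j → j < k →
         entry (P k κ) j ≥ entry (P k κ) (suc j)

-- (R3) interlacing, in the explicit form of the paper:
-- e = row i+1, d = row i̿, f = row ī, g = row i.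
R3 : ℕ → Pattern → Set
R3 n P =
  (∀ i j → 1 ≤ i → i < n → 1 ≤ j → j ≤ i →
     entry (P (suc i) unb) j ≥ entry (P i dbar) j ×
     entry (P i dbar) j ≥ entry (P (suc i) unb) (suc j))
  ×
  (∀ i j → 1 ≤ i → i ≤ n → 1 ≤ j → j ≤ i →
     entry (P i dbar) j ≥ entry (P i bar) j ×
     entry (P i bar) j ≥ entry (P i dbar) (suc j) ×
     entry (P i bar) j ≥ entry (P i unb) j ×
     entry (P i unb) j ≥ entry (P i bar) (suc j))

R4 : ℕ → Pattern → Set
R4 n P = ∀ i → 1 ≤ i → i ≤ n → entry (P i unb) i ≤ 1

R5 : ℕ → Pattern → Set
R5 n P = ∀ i j → 1 ≤ i → i < n → 1 ≤ j → j ≤ i →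
         entry (P i dbar) j ≡ entry (P (suc i) unb) j

Strict : ℕ → Pattern → Set
Strict n P = ∀ k κ j → 1 ≤ k → k ≤ n → 1 ≤ j → j < k →
             entry (P k κ) j > entry (P k κ) (suc j)

-- Vertices: (k , κ , c) with 1 ≤ k ≤ n and 1 ≤ c ≤ λ_n (c = column label).
-- The vertex (k , unb , 1) is the tie vertex (only W, N, S edges);
-- all others are ordinary.

IsTie : Kind → ℕ → Set
IsTie κ c = (κ ≡ unb) × (c ≡ 1)

-- Orientation of the horizontal edges (the vertical edges are fully
-- determined by P, see below).
--   H k κ c ≡ true  iff the horizontal edge immediately west of vertex
--                   (k , κ , c) points east (to the right).
--   bend k ≡ true   iff the bent edge joining the right ends of rows k̿
--                   and k̄ is traversed from row k̿ into row k̄.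
record HOrient : Set where
  field
    H    : ℕ → Kind → ℕ → Bool
    bend : ℕ → Bool
open HOrient public

-- North edge: the vertical edge above (k,κ,c) points up iff c is an
-- entry of row (k,κ); it points toward the vertex iff it points down.
NIn : Pattern → ℕ → Kind → ℕ → Set
NIn P k κ c = ¬ (c ∈ P k κ)

-- South edge: the edge above the vertex in the row below; it points toward
-- the vertex iff it points up.  Edges below row 1 point down.
SIn : Pattern → ℕ → Kind → ℕ → Set
SIn P zero          unb  c = ⊥
SIn P (suc zero)    unb  c = ⊥
SIn P (suc (suc k)) unb  c = c ∈ P (suc k) dbar
SIn P k             bar  c = c ∈ P k unb
SIn P k             dbar c = c ∈ P k bar

WIn : HOrient → ℕ → Kind → ℕ → Set
WIn O k κ c = H O k κ c ≡ true

-- East edge: for c ≥ 2 it is the west edge of (k,κ,c-1), toward the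
-- vertex iff it points west.  For c = 1 it is the bend (barred rows);
-- the tie vertex has no east edge.
EIn : HOrient → ℕ → Kind → ℕ → Set
EIn O k κ    (suc (suc c)) = H O k κ (suc c) ≡ false
EIn O k unb  (suc zero)    = ⊥
EIn O k bar  (suc zero)    = bend O k ≡ true
EIn O k dbar (suc zero)    = bend O k ≡ false
EIn O k κ    zero          = ⊥

data VType : Set where
  NW NE SW SE NS EW : VType

TypeOf : VType → (N S E W : Set) → Set
TypeOf NW N S E W = N × W × ¬ S × ¬ E
TypeOf NE N S E W = N × E × ¬ S × ¬ W
TypeOf SW N S E W = S × W × ¬ N × ¬ E
TypeOf SE N S E W = S × E × ¬ N × ¬ W
TypeOf NS N S E W = N × S × ¬ E × ¬ W
TypeOf EW N S E W = E × W × ¬ N × ¬ S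

HasType : Pattern → HOrient → VType → ℕ → Kind → ℕ → Set
HasType P O t k κ c =
  TypeOf t (NIn P k κ c) (SIn P k κ c) (EIn O k κ c) (WIn O k κ c)

IsKTOrientation : ℕ → Pattern → HOrient → Set
IsKTOrientation n P O =
  -- left boundary edges point right (into the lattice)
  (∀ k κ → 1 ≤ k → k ≤ n → 1 ≤ lambdaTop n P →
     H O k κ (lambdaTop n P) ≡ true)
  ×
  -- every ordinary vertex has two in- and two out-edges
  (∀ k κ c → 1 ≤ k → k ≤ n → 1 ≤ c → c ≤ lambdaTop n P → ¬ IsTie κ c →
     Σ VType λ t → HasType P O t k κ c)

TieU TieD TieO : Pattern → ℕ → Set
TieU P k = SIn P k unb 1 × ¬ NIn P k unb 1
TieD P k = NIn P k unb 1 × ¬ SIn P k unb 1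
TieO P k = ¬ NIn P k unb 1 × ¬ SIn P k unb 1

Cond2 : ℕ → Pattern → HOrient → Set
Cond2 n P O = ∀ k → 1 ≤ k → k ≤ n →
  (∀ c → 2 ≤ c → c ≤ lambdaTop n P →
     ¬ HasType P O NS k unb c × ¬ HasType P O SE k unb c ×
     ¬ HasType P O EW k unb c)
  ×
  (1 ≤ lambdaTop n P →
     WIn O k unb 1 × (TieU P k ⊎ TieD P k ⊎ TieO P k))

-- Call row k aligned when an edge enters column c of row k from below exactly for the entries c of
-- row k, except that an entry in column 1 may lack one. Both (1) and (2) are equivalent to the
-- alignment of every row.
--
-- (1) ⇒ alignment: by (R5) row (k−1)̿ consists of the first k−1 entries of row k, and by (R4) the last
-- entry is at most 1. Alignment ⇔ (2): once EW vertices are excluded, all west edges of row k point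
-- east, by induction from the left boundary, so the ordinary vertices are NW or SW; that says exactly
-- that row k is aligned in the columns c ≥ 2, and the tie types say the same for column 1.
--
-- Alignment ⇒ (1): conservation of flow through the rows k̄ and k̿, joined by the bend, shows that
-- row k̿ has one more entry in the columns 1, …, λₙ than row k. Alignment puts the entries of row
-- (k−1)̿ into row k, so by induction all k entries of row k̿ are positive. Interlacing and strictness
-- then force dⱼ = eⱼ from left to right, because an entry eⱼ ≥ 2 of row k+1 must reappear in row k̿;
-- and the last entry of row k cannot be ≥ 2, since it would reappear among its first k−1 entries.

module Submission where

open import Defs
open import Data.Nat using (ℕ)
open import Data.Product using (_×_)
open import Function.Bundles using (_⇔_)

open import Data.Bool using (true; false)
open import Data.Bool.Properties using (¬-not)
import Data.Bool as Bool
open import Data.Empty using (⊥-elim)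
open import Data.Nat using (zero; suc; _+_; _*_; _≤_; _<_; _<?_; _≤‴_; ≤‴-refl; ≤‴-step; z≤n; s≤s; _≟_; _≤?_)
open import Data.Nat.Properties
open import Data.Product using (∃; _,_; proj₁; proj₂)
open import Data.Sum using (_⊎_; inj₁; inj₂)
open import Data.Vec using (Vec; []; _∷_)
open import Data.Vec.Membership.DecPropositional _≟_ using (_∈_; _∈?_)
open import Data.Vec.Relation.Unary.Any using (here; there)
open import Function.Bundles using (mk⇔)
open import Relation.Nullary using (¬_; Dec; yes; no; ¬?)
open import Relation.Nullary.Decidable using (decidable-stable)
open import Algebra.Properties.CommutativeSemigroup +-commutativeSemigroup
  using () renaming (interchange to +-interchange; x∙yz≈y∙xz to +-exchange)
open import Relation.Binary.PropositionalEquality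
  using (_≡_; refl; sym; trans; cong; cong₂; subst; module ≡-Reasoning)

private
  variable
    A B : Set
    k : ℕ

[_] : Dec A → ℕ
[ yes _ ] = 1
[ no _ ]  = 0

[]-yes : A → (d : Dec A) → [ d ] ≡ 1
[]-yes a (yes _) = refl
[]-yes a (no ¬a) = ⊥-elim (¬a a)

[]-no : ¬ A → (d : Dec A) → [ d ] ≡ 0
[]-no ¬a (yes a) = ⊥-elim (¬a a)
[]-no ¬a (no _)  = refl

[]≤1 : (d : Dec A) → [ d ] ≤ 1
[]≤1 (yes _) = ≤-refl
[]≤1 (no _)  = z≤n

[]-mono : (A → B) → (a : Dec A) (b : Dec B) → [ a ] ≤ [ b ]
[]-mono f (yes a) (yes _) = ≤-refl
[]-mono f (yes a) (no ¬b) = ⊥-elim (¬b (f a))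
[]-mono f (no _)  _       = z≤n

[¬?]+[]≡1 : (d : Dec A) → [ ¬? d ] + [ d ] ≡ 1
[¬?]+[]≡1 (yes _) = refl
[¬?]+[]≡1 (no _)  = refl

sumTo : (ℕ → ℕ) → ℕ → ℕ
sumTo f zero    = 0
sumTo f (suc m) = sumTo f m + f (suc m)

sumTo-mono-≤ : ∀ f g m → (∀ c → 1 ≤ c → c ≤ m → f c ≤ g c) → sumTo f m ≤ sumTo g m
sumTo-mono-≤ f g zero    f≤g = z≤n
sumTo-mono-≤ f g (suc m) f≤g =
  +-mono-≤ (sumTo-mono-≤ f g m (λ c 1≤c c≤m → f≤g c 1≤c (m≤n⇒m≤1+n c≤m)))
           (f≤g (suc m) (s≤s z≤n) ≤-refl)

sumTo-distrib-+ : ∀ f g m → sumTo (λ c → f c + g c) m ≡ sumTo f m + sumTo g m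
sumTo-distrib-+ f g zero    = refl
sumTo-distrib-+ f g (suc m) =
  trans (cong (_+ (f (suc m) + g (suc m))) (sumTo-distrib-+ f g m))
        (+-interchange (sumTo f m) (sumTo g m) (f (suc m)) (g (suc m)))

sumTo-const : ∀ f m {a} → (∀ c → 1 ≤ c → c ≤ m → f c ≡ a) → sumTo f m ≡ m * a
sumTo-const f zero    f≡a = refl
sumTo-const f (suc m) {a} f≡a = begin
  sumTo f m + f (suc m) ≡⟨ cong₂ _+_ (sumTo-const f m (λ c 1≤c c≤m → f≡a c 1≤c (m≤n⇒m≤1+n c≤m)))
                                     (f≡a (suc m) (s≤s z≤n) ≤-refl) ⟩
  m * a + a             ≡⟨ +-comm (m * a) a ⟩
  suc m * a             ∎
  where open ≡-Reasoning

-- A row of in-degree-2 vertices in columns L, …, 1 (left to right): v, e, w count the in-pointing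
-- vertical, east and west edges, consecutive vertices share an edge, and the left boundary edge
-- points in.
rowFlow : ∀ L (v e w : ℕ → ℕ) →
  (∀ c → 1 ≤ c → c ≤ L → v c + e c + w c ≡ 2) →
  (∀ c → 1 ≤ c → c < L → e (suc c) + w c ≡ 1) →
  w L ≡ 1 → 1 ≤ L → e 1 + sumTo v L ≡ L
rowFlow L v e w vertex edge boundary (s≤s {n = m} _) =
  suc-injective (trans (+-comm 1 _) (trans (cong (e 1 + sumTo v L +_) (sym boundary)) (partial m ≤-refl)))
  where
  open ≡-Reasoning

  step : ∀ X {a} b ε ω {M} → X + a ≡ M → b + ε + ω ≡ 2 → ε + a ≡ 1 → X + b + ω ≡ suc M
  step X b zero ω p q refl = begin
    X + b + ω     ≡⟨ +-assoc X b ω ⟩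
    X + (b + ω)   ≡⟨ cong (X +_) (trans (cong (_+ ω) (sym (+-identityʳ b))) q) ⟩
    X + 2         ≡⟨ +-suc X 1 ⟩
    suc (X + 1)   ≡⟨ cong suc p ⟩
    _             ∎
  step X b (suc zero) ω p q refl = begin
    X + b + ω     ≡⟨ +-assoc X b ω ⟩
    X + (b + ω)   ≡⟨ cong (X +_) (suc-injective (trans (cong (_+ ω) (+-comm 1 b)) q)) ⟩
    X + 1         ≡⟨ +-suc X 0 ⟩
    suc (X + 0)   ≡⟨ cong suc p ⟩
    _             ∎

  partial : ∀ m → suc m ≤ L → e 1 + sumTo v (suc m) + w (suc m) ≡ suc (suc m)
  partial zero    1≤L = subst (λ x → x + w 1 ≡ 2) (+-comm (v 1) (e 1)) (vertex 1 ≤-refl 1≤L)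
  partial (suc m) m+2≤L =
    subst (_≡ suc (suc (suc m))) (cong (_+ w (suc (suc m))) (+-assoc (e 1) (sumTo v (suc m)) _))
      (step (e 1 + sumTo v (suc m)) (v (suc (suc m))) (e (suc (suc m))) (w (suc (suc m)))
        (partial m (<⇒≤ m+2≤L)) (vertex (suc (suc m)) (s≤s z≤n) m+2≤L) (edge (suc m) (s≤s z≤n) m+2≤L))

count : Vec ℕ k → ℕ → ℕ
count v m = sumTo (λ c → [ c ∈? v ]) m

count-mono : (v : Vec ℕ k) {k′ : ℕ} (w : Vec ℕ k′) (m : ℕ) →
  (∀ c → 1 ≤ c → c ≤ m → c ∈ v → c ∈ w) → count v m ≤ count w m
count-mono v w m v⊆w = sumTo-mono-≤ _ _ m (λ c 1≤c c≤m → []-mono (v⊆w c 1≤c c≤m) (c ∈? v) (c ∈? w))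

sumTo-[≟]≤1 : ∀ x m → sumTo (λ c → [ c ≟ x ]) m ≤ 1
sumTo-[≟]≤1 x zero    = z≤n
sumTo-[≟]≤1 x (suc m) with suc m ≟ x
... | no _       = subst (_≤ 1) (sym (+-identityʳ _)) (sumTo-[≟]≤1 x m)
... | yes refl = ≤-reflexive (cong (_+ 1) (trans (sumTo-const _ m none) (*-zeroʳ m)))
  where
  none : ∀ c → 1 ≤ c → c ≤ m → [ c ≟ suc m ] ≡ 0
  none c _ c≤m = []-no (λ { refl → 1+n≰n c≤m }) (c ≟ suc m)

count-∷ : ∀ x (v : Vec ℕ k) m → count (x ∷ v) m ≤ suc (count v m)
count-∷ x v m = begin
  count (x ∷ v) m                               ≤⟨ sumTo-mono-≤ _ _ m (λ c _ _ → pointwise c) ⟩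
  sumTo (λ c → [ c ≟ x ] + [ c ∈? v ]) m        ≡⟨ sumTo-distrib-+ _ _ m ⟩
  sumTo (λ c → [ c ≟ x ]) m + count v m         ≤⟨ +-monoˡ-≤ (count v m) (sumTo-[≟]≤1 x m) ⟩
  suc (count v m)                               ∎
  where
  open ≤-Reasoning
  pointwise : ∀ c → [ c ∈? x ∷ v ] ≤ [ c ≟ x ] + [ c ∈? v ]
  pointwise c = split (c ≟ x)
    where
    split : (c≟x : Dec (c ≡ x)) → [ c ∈? x ∷ v ] ≤ [ c≟x ] + [ c ∈? v ]
    split (yes _)  = ≤-trans ([]≤1 (c ∈? x ∷ v)) (s≤s z≤n)
    split (no c≢x) = []-mono (λ { (here c≡x) → ⊥-elim (c≢x c≡x) ; (there c∈v) → c∈v }) (c ∈? x ∷ v) (c ∈? v)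

count≤length : (v : Vec ℕ k) → ∀ m → count v m ≤ k
count≤length []      m = ≤-reflexive (trans (sumTo-const _ m (λ _ _ _ → refl)) (*-zeroʳ m))
count≤length (x ∷ v) m = ≤-trans (count-∷ x v m) (s≤s (count≤length v m))

0∈⇒count<length : (v : Vec ℕ k) → ∀ m → 0 ∈ v → count v m < k
0∈⇒count<length (x ∷ v) m (here refl) = s≤s (≤-trans (count-mono (0 ∷ v) v m drop0) (count≤length v m))
  where
  drop0 : ∀ c → 1 ≤ c → c ≤ m → c ∈ 0 ∷ v → c ∈ v
  drop0 c 1≤c _ (here refl) = ⊥-elim (1+n≰n 1≤c)
  drop0 c _   _ (there c∈v) = c∈v
0∈⇒count<length (x ∷ v) m (there 0∈v) = s≤s (≤-trans (count-∷ x v m) (0∈⇒count<length v m 0∈v))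

entry-beyond : (v : Vec ℕ k) → ∀ j → k < j → entry v j ≡ 0
entry-beyond []      j             _        = refl
entry-beyond (x ∷ v) (suc (suc j)) (s≤s k<j) = entry-beyond v (suc j) k<j

entry∈ : (v : Vec ℕ k) → ∀ j → 1 ≤ j → j ≤ k → entry v j ∈ v
entry∈ (x ∷ v) (suc zero)    _ _         = here refl
entry∈ (x ∷ v) (suc (suc j)) _ (s≤s j≤k) = there (entry∈ v (suc j) (s≤s z≤n) j≤k)

∈⇒entry : (v : Vec ℕ k) → ∀ {x} → x ∈ v → ∃ λ j → 1 ≤ j × j ≤ k × entry v j ≡ x
∈⇒entry (y ∷ v) (here x≡y) = 1 , ≤-refl , s≤s z≤n , sym x≡y
∈⇒entry (y ∷ v) (there x∈v) with ∈⇒entry v x∈v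
... | suc j , _ , j≤k , eq = suc (suc j) , s≤s z≤n , s≤s j≤k , eq

count≥length⇒entry-positive : (v : Vec ℕ k) → ∀ m → k ≤ count v m → ∀ j → 1 ≤ j → j ≤ k → 1 ≤ entry v j
count≥length⇒entry-positive v m k≤count j 1≤j j≤k with entry v j in vⱼ≡
... | suc _ = s≤s z≤n
... | zero  = ⊥-elim (<⇒≱ (0∈⇒count<length v m (subst (_∈ v) vⱼ≡ (entry∈ v j 1≤j j≤k))) k≤count)

StrictlyDecreasing : Vec ℕ k → Set
StrictlyDecreasing {k} v = ∀ j → 1 ≤ j → j < k → entry v (suc j) < entry v j

entry-strictAnti : (v : Vec ℕ k) → StrictlyDecreasing v →
  ∀ {i j} → 1 ≤ i → i < j → j ≤ k → entry v j < entry v i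
entry-strictAnti v decr {i} {suc j} 1≤i (s≤s i≤j) j<k with m≤n⇒m<n∨m≡n i≤j
... | inj₂ refl = decr i 1≤i j<k
... | inj₁ i<j  = <-trans (decr j (≤-trans 1≤i (<⇒≤ i<j)) j<k) (entry-strictAnti v decr 1≤i i<j (<⇒≤ j<k))

entry-anti : (v : Vec ℕ k) → StrictlyDecreasing v → ∀ {i j} → 1 ≤ i → i ≤ j → entry v j ≤ entry v i
entry-anti {k} v decr {i} {j} 1≤i i≤j with m≤n⇒m<n∨m≡n i≤j | j ≤? k
... | inj₂ refl | _      = ≤-refl
... | inj₁ i<j  | yes j≤k = <⇒≤ (entry-strictAnti v decr 1≤i i<j j≤k)
... | inj₁ _    | no j≰k  = subst (_≤ entry v i) (sym (entry-beyond v j (≰⇒> j≰k))) z≤n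

row-decreasing : ∀ {n} P → Strict n P → ∀ κ → 1 ≤ k → k ≤ n → StrictlyDecreasing (P k κ)
row-decreasing P strict κ 1≤k k≤n j = strict _ κ j 1≤k k≤n

module _ {n : ℕ} {P : Pattern} (r3 : R3 n P) (strict : Strict n P) where

  heads-ordered : 1 ≤ k → k ≤ n →
    entry (P k unb) 1 ≤ entry (P k bar) 1 × entry (P k bar) 1 ≤ entry (P k dbar) 1
  heads-ordered 1≤k k≤n with proj₂ r3 _ 1 1≤k k≤n ≤-refl 1≤k
  ... | f₁≤d₁ , _ , g₁≤f₁ , _ = g₁≤f₁ , f₁≤d₁

  head-dbar≤lambdaTop : 1 ≤ k → k ≤‴ n → entry (P k dbar) 1 ≤ lambdaTop n P
  head-dbar≤lambdaTop 1≤k ≤‴-refl = ≤-refl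
  head-dbar≤lambdaTop {k} 1≤k (≤‴-step k<n) = begin
    entry (P k dbar) 1        ≤⟨ proj₁ (proj₁ r3 k 1 1≤k (≤‴⇒≤ k<n) ≤-refl 1≤k) ⟩
    entry (P (suc k) unb) 1   ≤⟨ proj₁ (heads-ordered (s≤s z≤n) (≤‴⇒≤ k<n)) ⟩
    entry (P (suc k) bar) 1   ≤⟨ proj₂ (heads-ordered (s≤s z≤n) (≤‴⇒≤ k<n)) ⟩
    entry (P (suc k) dbar) 1  ≤⟨ head-dbar≤lambdaTop (s≤s z≤n) k<n ⟩
    lambdaTop n P             ∎
    where open ≤-Reasoning

  entry≤lambdaTop : ∀ κ → 1 ≤ k → k ≤ n → ∀ j → 1 ≤ j → entry (P k κ) j ≤ lambdaTop n P
  entry≤lambdaTop {k} κ 1≤k k≤n j 1≤j =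
    ≤-trans (entry-anti (P k κ) (row-decreasing P strict κ 1≤k k≤n) ≤-refl 1≤j) (head≤lambdaTop κ)
    where
    head-dbar : entry (P k dbar) 1 ≤ lambdaTop n P
    head-dbar = head-dbar≤lambdaTop 1≤k (≤⇒≤‴ k≤n)
    head≤lambdaTop : ∀ κ → entry (P k κ) 1 ≤ lambdaTop n P
    head≤lambdaTop dbar = head-dbar
    head≤lambdaTop bar  = ≤-trans (proj₂ (heads-ordered 1≤k k≤n)) head-dbar
    head≤lambdaTop unb  =
      ≤-trans (proj₁ (heads-ordered 1≤k k≤n)) (≤-trans (proj₂ (heads-ordered 1≤k k≤n)) head-dbar)

  lambdaTop≡0⇒R4×R5 : lambdaTop n P ≡ 0 → R4 n P × R5 n P
  lambdaTop≡0⇒R4×R5 top≡0 = (λ k 1≤k k≤n → subst (_≤ 1) (sym (zero-entry unb 1≤k k≤n k 1≤k)) z≤n)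
                 , (λ i j 1≤i i<n 1≤j _ → trans (zero-entry dbar 1≤i (<⇒≤ i<n) j 1≤j)
                                                (sym (zero-entry unb (s≤s z≤n) i<n j 1≤j)))
    where
    zero-entry : ∀ κ → 1 ≤ k → k ≤ n → ∀ j → 1 ≤ j → entry (P k κ) j ≡ 0
    zero-entry κ 1≤k k≤n j 1≤j = n≤0⇒n≡0 (subst (_ ≤_) top≡0 (entry≤lambdaTop κ 1≤k k≤n j 1≤j))

RowAligned : ℕ → Pattern → ℕ → Set
RowAligned n P k =
  (∀ c → 1 ≤ c → c ≤ lambdaTop n P → SIn P k unb c → c ∈ P k unb) ×
  (∀ c → 2 ≤ c → c ≤ lambdaTop n P → c ∈ P k unb → SIn P k unb c)

module _ {n : ℕ} {P : Pattern} (r5 : R5 n P) where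

  R5⇒S-in⇒entry : k ≤ n → ∀ c → SIn P k unb c → c ∈ P k unb
  R5⇒S-in⇒entry {suc (suc i)} k≤n c c∈d with ∈⇒entry (P (suc i) dbar) c∈d
  ... | j , 1≤j , j≤i , refl =
    subst (_∈ P (suc (suc i)) unb) (sym (r5 (suc i) j (s≤s z≤n) k≤n 1≤j j≤i))
      (entry∈ (P (suc (suc i)) unb) j 1≤j (m≤n⇒m≤1+n j≤i))

  R5⇒inner-entry-S-in : k ≤ n → ∀ j → 1 ≤ j → j < k → SIn P k unb (entry (P k unb) j)
  R5⇒inner-entry-S-in {suc zero}    k≤n j 1≤j (s≤s j≤0) = ⊥-elim (<⇒≱ 1≤j j≤0)
  R5⇒inner-entry-S-in {suc (suc i)} k≤n j 1≤j (s≤s j≤i) =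
    subst (_∈ P (suc i) dbar) (r5 (suc i) j (s≤s z≤n) k≤n 1≤j j≤i) (entry∈ (P (suc i) dbar) j 1≤j j≤i)

  R5⇒last-entry-not-S-in : Strict n P → 1 ≤ k → k ≤ n → ¬ SIn P k unb (entry (P k unb) k)
  R5⇒last-entry-not-S-in {suc zero}    strict 1≤k k≤n ()
  R5⇒last-entry-not-S-in {suc (suc i)} strict 1≤k k≤n eₖ∈d with ∈⇒entry (P (suc i) dbar) eₖ∈d
  ... | m , 1≤m , m≤i , dₘ≡eₖ =
    <-irrefl (trans (sym dₘ≡eₖ) (r5 (suc i) m (s≤s z≤n) k≤n 1≤m m≤i))
      (entry-strictAnti (P (suc (suc i)) unb) (row-decreasing P strict unb 1≤k k≤n) 1≤m (s≤s m≤i) ≤-refl)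

  R4∧R5⇒aligned : R4 n P → 1 ≤ k → k ≤ n → RowAligned n P k
  R4∧R5⇒aligned {k} r4 1≤k k≤n = (λ c _ _ → R5⇒S-in⇒entry k≤n c) , entry⇒S-in
    where
    entry⇒S-in : ∀ c → 2 ≤ c → c ≤ lambdaTop n P → c ∈ P k unb → SIn P k unb c
    entry⇒S-in c 2≤c _ c∈e with ∈⇒entry (P k unb) c∈e
    ... | j , 1≤j , j≤k , refl with m≤n⇒m<n∨m≡n j≤k
    ...   | inj₁ j<k  = R5⇒inner-entry-S-in k≤n j 1≤j j<k
    ...   | inj₂ refl = ⊥-elim (<⇒≱ 2≤c (r4 k 1≤k k≤n))

-- SIn reduces only once k is split, whatever the kind.
SIn? : ∀ P k κ c → Dec (SIn P k κ c)
SIn? P zero          unb  c = no λ ()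
SIn? P (suc zero)    unb  c = no λ ()
SIn? P (suc (suc k)) unb  c = c ∈? P (suc k) dbar
SIn? P zero          bar  c = c ∈? P zero unb
SIn? P (suc zero)    bar  c = c ∈? P (suc zero) unb
SIn? P (suc (suc k)) bar  c = c ∈? P (suc (suc k)) unb
SIn? P zero          dbar c = c ∈? P zero bar
SIn? P (suc zero)    dbar c = c ∈? P (suc zero) bar
SIn? P (suc (suc k)) dbar c = c ∈? P (suc (suc k)) bar

sumTo-SIn?-bar : ∀ P k m → sumTo (λ c → [ SIn? P k bar c ]) m ≡ count (P k unb) m
sumTo-SIn?-bar P zero          m = refl
sumTo-SIn?-bar P (suc zero)    m = refl
sumTo-SIn?-bar P (suc (suc k)) m = refl

sumTo-SIn?-dbar : ∀ P k m → sumTo (λ c → [ SIn? P k dbar c ]) m ≡ count (P k bar) m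
sumTo-SIn?-dbar P zero          m = refl
sumTo-SIn?-dbar P (suc zero)    m = refl
sumTo-SIn?-dbar P (suc (suc k)) m = refl

EIn? : ∀ O k κ c → Dec (EIn O k κ c)
EIn? O k κ    (suc (suc c)) = H O k κ (suc c) Bool.≟ false
EIn? O k unb  (suc zero)    = no λ ()
EIn? O k bar  (suc zero)    = bend O k Bool.≟ true
EIn? O k dbar (suc zero)    = bend O k Bool.≟ false
EIn? O k κ    zero          = no λ ()

WIn? : ∀ O k κ c → Dec (WIn O k κ c)
WIn? O k κ c = H O k κ c Bool.≟ true

[≟false]+[≟true]≡1 : ∀ b → [ b Bool.≟ false ] + [ b Bool.≟ true ] ≡ 1
[≟false]+[≟true]≡1 false = refl
[≟false]+[≟true]≡1 true  = refl

inDegree≡2 : ∀ t {N S E W : Set} (n? : Dec N) (s? : Dec S) (e? : Dec E) (w? : Dec W) →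
  TypeOf t N S E W → [ n? ] + [ s? ] + [ e? ] + [ w? ] ≡ 2
inDegree≡2 NW n? s? e? w? (n , w , ¬s , ¬e) rewrite []-yes n n? | []-no ¬s s? | []-no ¬e e? | []-yes w w? = refl
inDegree≡2 NE n? s? e? w? (n , e , ¬s , ¬w) rewrite []-yes n n? | []-no ¬s s? | []-yes e e? | []-no ¬w w? = refl
inDegree≡2 SW n? s? e? w? (s , w , ¬n , ¬e) rewrite []-no ¬n n? | []-yes s s? | []-no ¬e e? | []-yes w w? = refl
inDegree≡2 SE n? s? e? w? (s , e , ¬n , ¬w) rewrite []-no ¬n n? | []-yes s s? | []-yes e e? | []-no ¬w w? = refl
inDegree≡2 NS n? s? e? w? (n , s , ¬e , ¬w) rewrite []-yes n n? | []-yes s s? | []-no ¬e e? | []-no ¬w w? = refl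
inDegree≡2 EW n? s? e? w? (e , w , ¬n , ¬s) rewrite []-no ¬n n? | []-no ¬s s? | []-yes e e? | []-yes w w? = refl

westIn-type : ∀ t {N S E W : Set} → TypeOf t N S E W → W →
  (N × ¬ S × ¬ E) ⊎ (S × ¬ N × ¬ E) ⊎ TypeOf EW N S E W
westIn-type NW (n , _ , ¬s , ¬e) _ = inj₁ (n , ¬s , ¬e)
westIn-type SW (s , _ , ¬n , ¬e) _ = inj₂ (inj₁ (s , ¬n , ¬e))
westIn-type EW τ                 _ = inj₂ (inj₂ τ)
westIn-type NE (_ , _ , _ , ¬w)  w = ⊥-elim (¬w w)
westIn-type SE (_ , _ , _ , ¬w)  w = ⊥-elim (¬w w)
westIn-type NS (_ , _ , _ , ¬w)  w = ⊥-elim (¬w w)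

module Lattice {n : ℕ} {P : Pattern} {O : HOrient} (ori : IsKTOrientation n P O) where

  Λ : ℕ
  Λ = lambdaTop n P

  barredRow-balance : ∀ κ → ¬ κ ≡ unb → 1 ≤ k → k ≤ n → 1 ≤ Λ →
    [ EIn? O k κ 1 ] + sumTo (λ c → [ SIn? P k κ c ]) Λ ≡ count (P k κ) Λ
  barredRow-balance {k} κ κ≢unb 1≤k k≤n 1≤Λ =
    +-cancelˡ-≡ (sumTo N Λ) _ _ (begin
      sumTo N Λ + (E 1 + sumTo S Λ)    ≡⟨ +-exchange (sumTo N Λ) (E 1) (sumTo S Λ) ⟩
      E 1 + (sumTo N Λ + sumTo S Λ)    ≡⟨ cong (E 1 +_) (sym (sumTo-distrib-+ N S Λ)) ⟩
      E 1 + sumTo (λ c → N c + S c) Λ  ≡⟨ rowFlow Λ (λ c → N c + S c) E W vertex edge boundary 1≤Λ ⟩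
      Λ                                ≡⟨ sym complement ⟩
      sumTo N Λ + count (P k κ) Λ      ∎)
    where
    open ≡-Reasoning
    N S E W : ℕ → ℕ
    N c = [ ¬? (c ∈? P k κ) ]
    S c = [ SIn? P k κ c ]
    E c = [ EIn? O k κ c ]
    W c = [ WIn? O k κ c ]
    vertex : ∀ c → 1 ≤ c → c ≤ Λ → N c + S c + E c + W c ≡ 2
    vertex c 1≤c c≤Λ with proj₂ ori k κ c 1≤k k≤n 1≤c c≤Λ (λ tie → κ≢unb (proj₁ tie))
    ... | t , τ = inDegree≡2 t (¬? (c ∈? P k κ)) (SIn? P k κ c) (EIn? O k κ c) (WIn? O k κ c) τ
    edge : ∀ c → 1 ≤ c → c < Λ → E (suc c) + W c ≡ 1
    edge (suc c) _ _ = [≟false]+[≟true]≡1 (H O k κ (suc c))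
    boundary : W Λ ≡ 1
    boundary = []-yes (proj₁ ori k κ 1≤k k≤n 1≤Λ) _
    complement : sumTo N Λ + count (P k κ) Λ ≡ Λ
    complement = trans (sym (sumTo-distrib-+ N _ Λ))
      (trans (sumTo-const _ Λ (λ c _ _ → [¬?]+[]≡1 (c ∈? P k κ))) (*-identityʳ Λ))

  count-dbar : 1 ≤ k → k ≤ n → 1 ≤ Λ → count (P k dbar) Λ ≡ suc (count (P k unb) Λ)
  count-dbar {k} 1≤k k≤n 1≤Λ = begin
    count (P k dbar) Λ
      ≡⟨ sym (barredRow-balance dbar (λ ()) 1≤k k≤n 1≤Λ) ⟩
    [ EIn? O k dbar 1 ] + sumTo (λ c → [ SIn? P k dbar c ]) Λ
      ≡⟨ cong ([ EIn? O k dbar 1 ] +_) (sumTo-SIn?-dbar P k Λ) ⟩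
    [ EIn? O k dbar 1 ] + count (P k bar) Λ
      ≡⟨ cong ([ EIn? O k dbar 1 ] +_) (sym (barredRow-balance bar (λ ()) 1≤k k≤n 1≤Λ)) ⟩
    [ EIn? O k dbar 1 ] + ([ EIn? O k bar 1 ] + sumTo (λ c → [ SIn? P k bar c ]) Λ)
      ≡⟨ sym (+-assoc [ EIn? O k dbar 1 ] [ EIn? O k bar 1 ] _) ⟩
    [ EIn? O k dbar 1 ] + [ EIn? O k bar 1 ] + sumTo (λ c → [ SIn? P k bar c ]) Λ
      ≡⟨ cong₂ _+_ ([≟false]+[≟true]≡1 (bend O k)) (sumTo-SIn?-bar P k Λ) ⟩
    suc (count (P k unb) Λ) ∎
    where open ≡-Reasoning

  module UnbarredRow (k : ℕ) (1≤k : 1 ≤ k) (k≤n : k ≤ n)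
                     (noEW : ∀ c → 2 ≤ c → c ≤ Λ → ¬ HasType P O EW k unb c) where

    westIn-ordinary : ∀ c → 2 ≤ c → c ≤ Λ → WIn O k unb c →
      (NIn P k unb c × ¬ SIn P k unb c × ¬ EIn O k unb c) ⊎
      (SIn P k unb c × ¬ NIn P k unb c × ¬ EIn O k unb c)
    westIn-ordinary c 2≤c c≤Λ w
      with proj₂ ori k unb c 1≤k k≤n (<⇒≤ 2≤c) c≤Λ (λ { (_ , refl) → 1+n≰n 2≤c })
    ... | t , τ with westIn-type t τ w
    ...   | inj₁ nw         = inj₁ nw
    ...   | inj₂ (inj₁ sw) = inj₂ sw
    ...   | inj₂ (inj₂ ew) = ⊥-elim (noEW c 2≤c c≤Λ ew)

    westIn : ∀ {c} → c ≤‴ Λ → 1 ≤ c → WIn O k unb c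
    westIn ≤‴-refl 1≤c = proj₁ ori k unb 1≤k k≤n 1≤c
    westIn {suc c} (≤‴-step c<Λ) _
      with westIn-ordinary (suc (suc c)) (s≤s (s≤s z≤n)) (≤‴⇒≤ c<Λ) (westIn c<Λ (s≤s z≤n))
    ... | inj₁ (_ , _ , ¬e) = ¬-not ¬e
    ... | inj₂ (_ , _ , ¬e) = ¬-not ¬e

    ordinary-aligned : ∀ c → 2 ≤ c → c ≤ Λ →
      (SIn P k unb c → c ∈ P k unb) × (c ∈ P k unb → SIn P k unb c)
    ordinary-aligned c 2≤c c≤Λ with westIn-ordinary c 2≤c c≤Λ (westIn (≤⇒≤‴ c≤Λ) (<⇒≤ 2≤c))
    ... | inj₁ (c∉ , ¬s , _) = (λ s → ⊥-elim (¬s s)) , (λ c∈ → ⊥-elim (c∉ c∈))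
    ... | inj₂ (s , ¬c∉ , _) = (λ _ → decidable-stable (c ∈? P k unb) ¬c∉) , (λ _ → s)

  Cond2⇒aligned : 1 ≤ Λ → Cond2 n P O → 1 ≤ k → k ≤ n → RowAligned n P k
  Cond2⇒aligned {k} 1≤Λ cond2 1≤k k≤n = S-in⇒entry , λ c 2≤c c≤Λ → proj₂ (ordinary-aligned c 2≤c c≤Λ)
    where
    open UnbarredRow k 1≤k k≤n (λ c 2≤c c≤Λ → proj₂ (proj₂ (proj₁ (cond2 k 1≤k k≤n) c 2≤c c≤Λ)))
    S-in⇒entry : ∀ c → 1 ≤ c → c ≤ Λ → SIn P k unb c → c ∈ P k unb
    S-in⇒entry (suc (suc c)) _ c≤Λ = proj₁ (ordinary-aligned (suc (suc c)) (s≤s (s≤s z≤n)) c≤Λ)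
    S-in⇒entry (suc zero) _ _ s with proj₂ (proj₂ (cond2 k 1≤k k≤n) 1≤Λ)
    ... | inj₁ (_ , ¬1∉)        = decidable-stable (1 ∈? P k unb) ¬1∉
    ... | inj₂ (inj₁ (_ , ¬s)) = ⊥-elim (¬s s)
    ... | inj₂ (inj₂ (_ , ¬s)) = ⊥-elim (¬s s)

  aligned⇒Cond2 : (∀ {k} → 1 ≤ k → k ≤ n → RowAligned n P k) → Cond2 n P O
  aligned⇒Cond2 aligned k 1≤k k≤n = ordinary , tie
    where
    S-in⇒entry : ∀ c → 1 ≤ c → c ≤ Λ → SIn P k unb c → c ∈ P k unb
    S-in⇒entry = proj₁ (aligned 1≤k k≤n)
    entry⇒S-in : ∀ c → 2 ≤ c → c ≤ Λ → c ∈ P k unb → SIn P k unb c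
    entry⇒S-in = proj₂ (aligned 1≤k k≤n)

    noEW : ∀ c → 2 ≤ c → c ≤ Λ → ¬ HasType P O EW k unb c
    noEW c 2≤c c≤Λ (_ , _ , ¬c∉ , ¬s) = ¬s (entry⇒S-in c 2≤c c≤Λ (decidable-stable (c ∈? P k unb) ¬c∉))

    open UnbarredRow k 1≤k k≤n noEW

    ordinary : ∀ c → 2 ≤ c → c ≤ Λ →
      ¬ HasType P O NS k unb c × ¬ HasType P O SE k unb c × ¬ HasType P O EW k unb c
    ordinary c 2≤c c≤Λ = (λ { (c∉ , s , _ , _) → c∉ (S-in⇒entry c (<⇒≤ 2≤c) c≤Λ s) })
                       , (λ { (_ , _ , _ , ¬w) → ¬w (westIn (≤⇒≤‴ c≤Λ) (<⇒≤ 2≤c)) })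
                       , noEW c 2≤c c≤Λ

    tie : 1 ≤ Λ → WIn O k unb 1 × (TieU P k ⊎ TieD P k ⊎ TieO P k)
    tie 1≤Λ = westIn (≤⇒≤‴ 1≤Λ) ≤-refl , tieType (SIn? P k unb 1) (1 ∈? P k unb)
      where
      tieType : Dec (SIn P k unb 1) → Dec (1 ∈ P k unb) → TieU P k ⊎ TieD P k ⊎ TieO P k
      tieType (yes s) _        = inj₁ (s , λ 1∉ → 1∉ (S-in⇒entry 1 ≤-refl 1≤Λ s))
      tieType (no ¬s) (yes 1∈) = inj₂ (inj₂ ((λ 1∉ → 1∉ 1∈) , ¬s))
      tieType (no ¬s) (no 1∉)  = inj₂ (inj₁ (1∉ , ¬s))

  dbar-count≥ : (∀ {k} → 1 ≤ k → k ≤ n → RowAligned n P k) → 1 ≤ Λ →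
    ∀ k → 1 ≤ k → k ≤ n → k ≤ count (P k dbar) Λ
  dbar-count≥ aligned 1≤Λ (suc zero) 1≤k k≤n =
    subst (1 ≤_) (sym (count-dbar 1≤k k≤n 1≤Λ)) (s≤s z≤n)
  dbar-count≥ aligned 1≤Λ (suc (suc k)) 1≤k k≤n = begin
    suc (suc k)                          ≤⟨ s≤s (dbar-count≥ aligned 1≤Λ (suc k) (s≤s z≤n) (<⇒≤ k≤n)) ⟩
    suc (count (P (suc k) dbar) Λ)       ≤⟨ s≤s (count-mono _ _ Λ (proj₁ (aligned 1≤k k≤n))) ⟩
    suc (count (P (suc (suc k)) unb) Λ)  ≡⟨ sym (count-dbar 1≤k k≤n 1≤Λ) ⟩
    count (P (suc (suc k)) dbar) Λ       ∎
    where open ≤-Reasoning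

module _ {n : ℕ} {P : Pattern} (r3 : R3 n P) (strict : Strict n P)
         (aligned : ∀ {k} → 1 ≤ k → k ≤ n → RowAligned n P k)
         (dbar-positive : ∀ {k} j → 1 ≤ k → k ≤ n → 1 ≤ j → j ≤ k → 1 ≤ entry (P k dbar) j) where

  -- If dⱼ < eⱼ, then eⱼ ≥ 2 reappears in row i̿ as some dₘ: m < j contradicts dₘ = eₘ > eⱼ and
  -- m ≥ j contradicts dₘ ≤ dⱼ.
  dbar≡unb-step : ∀ {i} j → 1 ≤ i → i < n → 1 ≤ j → j ≤ i →
    (∀ m → 1 ≤ m → m < j → entry (P i dbar) m ≡ entry (P (suc i) unb) m) →
    entry (P i dbar) j ≡ entry (P (suc i) unb) j
  dbar≡unb-step {suc i} j 1≤i i<n 1≤j j≤i agree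
    with m≤n⇒m<n∨m≡n (proj₁ (proj₁ r3 (suc i) j 1≤i i<n 1≤j j≤i))
  ... | inj₂ dⱼ≡eⱼ = dⱼ≡eⱼ
  ... | inj₁ dⱼ<eⱼ with ∈⇒entry d eⱼ∈d
    where
    d : Vec ℕ (suc i)
    d = P (suc i) dbar
    e : Vec ℕ (suc (suc i))
    e = P (suc (suc i)) unb
    eⱼ∈d : entry e j ∈ d
    eⱼ∈d = proj₂ (aligned (s≤s z≤n) i<n) (entry e j)
             (≤-trans (s≤s (dbar-positive j 1≤i (<⇒≤ i<n) 1≤j j≤i)) dⱼ<eⱼ)
             (entry≤lambdaTop {P = P} r3 strict unb (s≤s z≤n) i<n j 1≤j)
             (entry∈ e j 1≤j (m≤n⇒m≤1+n j≤i))
  ... | m , 1≤m , m≤i , dₘ≡eⱼ with m <? j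
  ...   | yes m<j = ⊥-elim (<-irrefl (trans (sym dₘ≡eⱼ) (agree m 1≤m m<j))
                      (entry-strictAnti (P (suc (suc i)) unb) (row-decreasing P strict unb (s≤s z≤n) i<n)
                         1≤m m<j (m≤n⇒m≤1+n j≤i)))
  ...   | no m≮j  = ⊥-elim (<⇒≱ dⱼ<eⱼ (subst (_≤ entry (P (suc i) dbar) j) dₘ≡eⱼ
                      (entry-anti (P (suc i) dbar) (row-decreasing P strict dbar 1≤i (<⇒≤ i<n)) 1≤j (≮⇒≥ m≮j))))

  aligned⇒R5 : R5 n P
  aligned⇒R5 i j 1≤i i<n 1≤j j≤i = agree-upTo j j≤i j 1≤j ≤-refl
    where
    agree-upTo : ∀ j → j ≤ i → ∀ m → 1 ≤ m → m ≤ j → entry (P i dbar) m ≡ entry (P (suc i) unb) m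
    agree-upTo zero    _     m 1≤m m≤0   = ⊥-elim (<⇒≱ 1≤m m≤0)
    agree-upTo (suc j) j+1≤i m 1≤m m≤j+1 with m≤n⇒m<n∨m≡n m≤j+1
    ... | inj₁ m<j+1 = agree-upTo j (<⇒≤ j+1≤i) m 1≤m (≤-pred m<j+1)
    ... | inj₂ refl  = dbar≡unb-step (suc j) 1≤i i<n 1≤m j+1≤i
                         (λ m′ 1≤m′ m′<m → agree-upTo j (<⇒≤ j+1≤i) m′ 1≤m′ (≤-pred m′<m))

  aligned⇒R4 : R4 n P
  aligned⇒R4 k 1≤k k≤n with entry (P k unb) k ≤? 1
  ... | yes eₖ≤1 = eₖ≤1
  ... | no eₖ≰1  = ⊥-elim (R5⇒last-entry-not-S-in {P = P} aligned⇒R5 strict 1≤k k≤n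
                     (proj₂ (aligned 1≤k k≤n) _ (≰⇒> eₖ≰1)
                        (entry≤lambdaTop {P = P} r3 strict unb 1≤k k≤n k 1≤k) (entry∈ (P k unb) k 1≤k ≤-refl)))

mainTheorem5 : (n : ℕ) (P : Pattern) (O : HOrient) →
    R2 n P → R3 n P → Strict n P → IsKTOrientation n P O →
    ((R4 n P × R5 n P) ⇔ Cond2 n P O)
mainTheorem5 n P O _ r3 strict ori = mk⇔ forward backward   -- (R2) follows from strictness
  where
  open Lattice ori

  forward : R4 n P × R5 n P → Cond2 n P O
  forward (r4 , r5) = aligned⇒Cond2 (R4∧R5⇒aligned {P = P} r5 r4)

  backward : Cond2 n P O → R4 n P × R5 n P
  backward cond2 with Λ ≟ 0
  ... | yes Λ≡0 = lambdaTop≡0⇒R4×R5 {P = P} r3 strict Λ≡0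
  ... | no Λ≢0  =
    aligned⇒R4 {P = P} r3 strict aligned positive , aligned⇒R5 {P = P} r3 strict aligned positive
    where
    1≤Λ : 1 ≤ Λ
    1≤Λ = n≢0⇒n>0 Λ≢0
    aligned : ∀ {k} → 1 ≤ k → k ≤ n → RowAligned n P k
    aligned = Cond2⇒aligned 1≤Λ cond2
    positive : ∀ {k} j → 1 ≤ k → k ≤ n → 1 ≤ j → j ≤ k → 1 ≤ entry (P k dbar) j
    positive {k} j 1≤k k≤n =
      count≥length⇒entry-positive (P k dbar) Λ (dbar-count≥ aligned 1≤Λ k 1≤k k≤n) j
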